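{- Let $p$ be a prime, let $H$ be a graph with vertex set $[m]$ and edge set $E$, and let $\lambda_1,\dots,\lambda_m$ be distinct elements of $\mathbb{F}_p$; write $\lambda_{ij} = \lambda_j - \lambda_i$. Let $G_p(H)$ be the graph with vertex set $\bigcup_{i=1}^m X_i$, $X_i = \mathbb{F}_p^2 \times \{i\}$, in which, for each $\{i,j\} \in E$, $(x,i)$ is adjacent to $(y,j)$ if and only if $y = x + \lambda_{ij}(a,a^2)$ for some $a \in \mathbb{F}_p^*$, and there are no other edges. For $v \in \mathbb{F}_p^2$ and $a \in \mathbb{F}_p^*$, let $H(v,a)$ be the subgraph of $G_p(H)$ induced by $\{(v + \lambda_i(a,a^2), i) : i \in [m]\}$. If $C = (x,i)(y,j)(z,k)(w,l)$ is a cycle of length four in $G_p(H)$ and the vertices $(x,i),(y,j),(z,k)$ all lie in $H(v,a)$, then $C \subseteq H(v,a)$.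
   Context: Scalar multiplication $\lambda(a,a^2)$ is componentwise in $\mathbb{F}_p^2$. -}

module Defs where

open import Data.Nat as ℕ using (ℕ; NonZero; _∸_)
open import Data.Nat.DivMod using (_mod_)
open import Data.Fin using (Fin; toℕ)
open import Data.Product using (_×_; _,_; Σ; ∃)
open import Relation.Binary.PropositionalEquality using (_≡_; _≢_)
open import Relation.Nullary using (¬_)

𝔽 : ℕ → Set
𝔽 p = Fin p

Point : ℕ → Set
Point p = 𝔽 p × 𝔽 p

module _ {p : ℕ} .{{_ : NonZero p}} where

  0F : 𝔽 p
  0F = 0 mod p

  _+F_ : 𝔽 p → 𝔽 p → 𝔽 p
  a +F b = (toℕ a ℕ.+ toℕ b) mod p

  _*F_ : 𝔽 p → 𝔽 p → 𝔽 p
  a *F b = (toℕ a ℕ.* toℕ b) mod p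

  -F_ : 𝔽 p → 𝔽 p
  -F a = (p ∸ toℕ a) mod p

  _-F_ : 𝔽 p → 𝔽 p → 𝔽 p
  a -F b = a +F (-F b)

  _+P_ : Point p → Point p → Point p
  (x₁ , x₂) +P (y₁ , y₂) = (x₁ +F y₁ , x₂ +F y₂)

  _·par_ : 𝔽 p → 𝔽 p → Point p
  l ·par a = (l *F a , l *F (a *F a))

record Graph (m : ℕ) : Set₁ where
  field
    E      : Fin m → Fin m → Set
    E-sym  : ∀ {i j} → E i j → E j i
    E-irr  : ∀ {i} → ¬ E i i

open Graph public

Vertex : ℕ → ℕ → Set
Vertex p m = Point p × Fin m

module _ {p : ℕ} .{{_ : NonZero p}} {m : ℕ} (H : Graph m) (lam : Fin m → 𝔽 p) where

  Adj : Vertex p m → Vertex p m → Set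
  Adj (x , i) (y , j) =
    E H i j × Σ (𝔽 p) (λ a → (a ≢ 0F) × (y ≡ x +P ((lam j -F lam i) ·par a)))

  IsFourCycle : Vertex p m → Vertex p m → Vertex p m → Vertex p m → Set
  IsFourCycle u₁ u₂ u₃ u₄ =
    (u₁ ≢ u₂) × (u₁ ≢ u₃) × (u₁ ≢ u₄) × (u₂ ≢ u₃) × (u₂ ≢ u₄) × (u₃ ≢ u₄) ×
    Adj u₁ u₂ × Adj u₂ u₃ × Adj u₃ u₄ × Adj u₄ u₁

  InHva : Point p → 𝔽 p → Vertex p m → Set
  InHva v a (x , i) = x ≡ v +P (lam i ·par a)

-- Write P(t) = (t, t²), α = λ_l − λ_k and β = λ_i − λ_l, where the cycle passes through
-- (x,i), (z,k) ∈ H(v,a) and (w,l). Walking from (z,k) to (w,l) to (x,i) adds αP(b) + βP(c),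
-- while x − z = (α + β)P(a); hence α(P(b) − P(a)) + β(P(c) − P(a)) = 0. Eliminating c from
-- the two coordinates gives α(α + β)(b − a)² = 0. Now α ≠ 0 because kl is an edge, and
-- α + β = λ_i − λ_k ≠ 0 because (x,i) ≠ (z,k); so b = a and w = v + λ_l P(a).
-- Arithmetic in 𝔽ₚ = Fin p is carried out in ℤ modulo p.

module Submission where

open import Defs
open import Data.Nat using (ℕ; NonZero)
open import Data.Nat.Primality using (Prime)
open import Data.Fin using (Fin)
open import Data.Product using (_×_)
open import Relation.Binary.PropositionalEquality using (_≡_; _≢_)
open import Function.Definitions using (Injective)

import Data.Nat as ℕ
import Data.Nat.Properties as ℕ
import Data.Nat.Divisibility as ℕ
open import Data.Nat.DivMod using (_mod_; _%_; _/_; m≡m%n+[m/n]*n; m%n<n; m<n⇒m%n≡m)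
open import Data.Nat.Primality using (euclidsLemma)
open import Data.Integer using (ℤ; +_; 0ℤ; 1ℤ; _⊖_; _+_; _*_; -_; _-_; ∣_∣)
open import Data.Integer.Properties
  using (+-inverseʳ; +-injective; pos-+; pos-*; abs-*; ⊖-≥; [+m]-[+n]≡m⊖n; ∣m⊝n∣≤m⊔n; ∣i∣≡0⇒i≡0; i-j≡0⇒i≡j)
open import Data.Integer.Divisibility.Signed
  using (_∣_; divides; ∣ᵤ⇒∣; ∣⇒∣ᵤ; ∣m∣n⇒∣m+n; ∣m∣n⇒∣m-n; ∣m⇒∣-m; ∣n⇒∣m*n; ∣m⇒∣m*n)
open import Data.Integer.Tactic.RingSolver using (solve-∀)
open import Data.Fin using (toℕ)
open import Data.Fin.Properties using (toℕ-fromℕ<; toℕ-injective; toℕ<n)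
open import Data.Product using (_,_; proj₁; proj₂)
open import Data.Sum using (_⊎_; inj₁; inj₂)
import Data.Sum as Sum
open import Relation.Nullary using (contradiction)
open import Function using (_∘_)
open import Relation.Binary.Bundles using (Setoid)
open import Relation.Binary.Structures using (IsEquivalence)
import Relation.Binary.Reasoning.Setoid as SetoidReasoning
open import Relation.Binary.PropositionalEquality using (refl; sym; trans; cong; cong₂; subst)

module ModularArithmetic (p : ℕ) where

  infix 4 _≋_
  record _≋_ (x y : ℤ) : Set where
    constructor mk≋
    field ≋⇒∣ : + p ∣ x - y
  open _≋_ public

  ≋-isEquivalence : IsEquivalence _≋_
  ≋-isEquivalence = record
    { refl  = λ {x} → mk≋ (divides 0ℤ (+-inverseʳ x))
    ; sym   = λ {x} {y} x≋y → mk≋ (subst (+ p ∣_) (negate x y) (∣m⇒∣-m (≋⇒∣ x≋y)))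
    ; trans = λ {x} {y} {z} x≋y y≋z → mk≋ (subst (+ p ∣_) (chain x y z) (∣m∣n⇒∣m+n (≋⇒∣ x≋y) (≋⇒∣ y≋z)))
    }
    where
    negate : ∀ x y → - (x - y) ≡ y - x
    negate = solve-∀
    chain : ∀ x y z → (x - y) + (y - z) ≡ x - z
    chain = solve-∀

  ≋-setoid : Setoid _ _
  ≋-setoid = record { isEquivalence = ≋-isEquivalence }

  open IsEquivalence ≋-isEquivalence public
    using () renaming (refl to ≋-refl; sym to ≋-sym; trans to ≋-trans; reflexive to ≋-reflexive)
  open SetoidReasoning ≋-setoid

  +-cong : ∀ {x x′ y y′} → x ≋ x′ → y ≋ y′ → x + y ≋ x′ + y′
  +-cong {x} {x′} {y} {y′} x≋x′ y≋y′ =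
    mk≋ (subst (+ p ∣_) (regroup x x′ y y′) (∣m∣n⇒∣m+n (≋⇒∣ x≋x′) (≋⇒∣ y≋y′)))
    where
    regroup : ∀ x x′ y y′ → (x - x′) + (y - y′) ≡ (x + y) - (x′ + y′)
    regroup = solve-∀

  *-cong : ∀ {x x′ y y′} → x ≋ x′ → y ≋ y′ → x * y ≋ x′ * y′
  *-cong {x} {x′} {y} {y′} x≋x′ y≋y′ =
    mk≋ (subst (+ p ∣_) (regroup x x′ y y′) (∣m∣n⇒∣m+n (∣m⇒∣m*n y (≋⇒∣ x≋x′)) (∣n⇒∣m*n x′ (≋⇒∣ y≋y′))))
    where
    regroup : ∀ x x′ y y′ → (x - x′) * y + x′ * (y - y′) ≡ x * y - x′ * y′
    regroup = solve-∀

  +-multiple : ∀ x k → x + k * + p ≋ x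
  +-multiple x k = mk≋ (divides k (cancel x k (+ p)))
    where
    cancel : ∀ x k p → (x + k * p) - x ≡ k * p
    cancel = solve-∀

  p∣x*y⇒p∣x⊎p∣y : Prime p → ∀ x y → + p ∣ x * y → (+ p ∣ x) ⊎ (+ p ∣ y)
  p∣x*y⇒p∣x⊎p∣y p-prime x y p∣xy =
    Sum.map ∣ᵤ⇒∣ ∣ᵤ⇒∣ (euclidsLemma ∣ x ∣ ∣ y ∣ p-prime (subst (p ℕ.∣_) (abs-* x y) (∣⇒∣ᵤ p∣xy)))

  private
    elimination : ∀ α β a b c →
      β * (α * (b * b - a * a) + β * (c * c - a * a))
        - (+ 2 * a * β + β * (c - a) - α * (b - a)) * (α * (b - a) + β * (c - a))
      ≡ α * ((b - a) * ((b - a) * (α + β)))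
    elimination = solve-∀

  parabola-chords-eliminate : ∀ α β a b c →
    + p ∣ α * (b - a) + β * (c - a) →
    + p ∣ α * (b * b - a * a) + β * (c * c - a * a) →
    + p ∣ α * ((b - a) * ((b - a) * (α + β)))
  parabola-chords-eliminate α β a b c linear quadratic = subst (+ p ∣_) (elimination α β a b c)
    (∣m∣n⇒∣m-n (∣n⇒∣m*n β quadratic) (∣n⇒∣m*n (+ 2 * a * β + β * (c - a) - α * (b - a)) linear))

  parabola-chords-collapse : Prime p → ∀ α β a b c →
    + p ∣ α * (b - a) + β * (c - a) →
    + p ∣ α * (b * b - a * a) + β * (c * c - a * a) →
    (+ p ∣ α) ⊎ (+ p ∣ α + β) ⊎ (+ p ∣ b - a)
  parabola-chords-collapse p-prime α β a b c linear quadratic =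
    split (parabola-chords-eliminate α β a b c linear quadratic)
    where
    split : + p ∣ α * ((b - a) * ((b - a) * (α + β))) → (+ p ∣ α) ⊎ (+ p ∣ α + β) ⊎ (+ p ∣ b - a)
    split p∣product with p∣x*y⇒p∣x⊎p∣y p-prime α _ p∣product
    ... | inj₁ p∣α = inj₁ p∣α
    ... | inj₂ p∣rest with p∣x*y⇒p∣x⊎p∣y p-prime (b - a) _ p∣rest
    ...   | inj₁ p∣b-a = inj₂ (inj₂ p∣b-a)
    ...   | inj₂ p∣rest′ with p∣x*y⇒p∣x⊎p∣y p-prime (b - a) _ p∣rest′
    ...     | inj₁ p∣b-a = inj₂ (inj₂ p∣b-a)
    ...     | inj₂ p∣α+β = inj₂ (inj₁ p∣α+β)

  private
    difference : ∀ v Li Lk Ll A B C →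
      (v + Lk * A + (Ll - Lk) * B + (Li - Ll) * C) - (v + Li * A)
      ≡ (Ll - Lk) * (B - A) + (Li - Ll) * (C - A)
    difference = solve-∀

  cycle-closing : ∀ {v x z w} Li Lk Ll A B C →
    x ≋ v + Li * A → z ≋ v + Lk * A → w ≋ z + (Ll - Lk) * B → x ≋ w + (Li - Ll) * C →
    + p ∣ (Ll - Lk) * (B - A) + (Li - Ll) * (C - A)
  cycle-closing {v} {x} {z} {w} Li Lk Ll A B C x≋ z≋ w≋ x≋′ =
    subst (+ p ∣_) (difference v Li Lk Ll A B C) (≋⇒∣ around)
    where
    around : v + Lk * A + (Ll - Lk) * B + (Li - Ll) * C ≋ v + Li * A
    around = begin
      v + Lk * A + (Ll - Lk) * B + (Li - Ll) * C  ≈⟨ +-cong (+-cong (≋-sym z≋) ≋-refl) ≋-refl ⟩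
      z + (Ll - Lk) * B + (Li - Ll) * C           ≈⟨ +-cong (≋-sym w≋) ≋-refl ⟩
      w + (Li - Ll) * C                           ≈⟨ ≋-sym x≋′ ⟩
      x                                           ≈⟨ x≋ ⟩
      v + Li * A                                  ∎

  private
    telescope : ∀ v Lk Ll T → v + Lk * T + (Ll - Lk) * T ≡ v + Ll * T
    telescope = solve-∀

  shift-compose : ∀ {v z w} Lk Ll T → w ≋ z + (Ll - Lk) * T → z ≋ v + Lk * T → w ≋ v + Ll * T
  shift-compose {v} {z} {w} Lk Ll T w≋ z≋ = begin
    w                               ≈⟨ w≋ ⟩
    z + (Ll - Lk) * T               ≈⟨ +-cong z≋ ≋-refl ⟩
    v + Lk * T + (Ll - Lk) * T      ≡⟨ telescope v Lk Ll T ⟩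
    v + Ll * T                      ∎

module Residues (p : ℕ) .{{_ : NonZero p}} where

  open ModularArithmetic p
  open SetoidReasoning ≋-setoid

  toℤ : 𝔽 p → ℤ
  toℤ x = + toℕ x

  toℤ-mod : ∀ n → toℤ (n mod p) ≋ + n
  toℤ-mod n = begin
    toℤ (n mod p)                  ≡⟨ cong +_ (toℕ-fromℕ< (m%n<n n p)) ⟩
    + (n % p)                      ≈⟨ ≋-sym (+-multiple (+ (n % p)) (+ (n / p))) ⟩
    + (n % p) + + (n / p) * + p    ≡⟨ cong (_+_ (+ (n % p))) (pos-* (n / p) p) ⟨
    + (n % p) + + (n / p ℕ.* p)    ≡⟨ pos-+ (n % p) (n / p ℕ.* p) ⟨
    + (n % p ℕ.+ n / p ℕ.* p)      ≡⟨ cong +_ (m≡m%n+[m/n]*n n p) ⟨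
    + n                            ∎

  toℤ-+F : ∀ x y → toℤ (x +F y) ≋ toℤ x + toℤ y
  toℤ-+F x y = ≋-trans (toℤ-mod (toℕ x ℕ.+ toℕ y)) (≋-reflexive (pos-+ (toℕ x) (toℕ y)))

  toℤ-*F : ∀ x y → toℤ (x *F y) ≋ toℤ x * toℤ y
  toℤ-*F x y = ≋-trans (toℤ-mod (toℕ x ℕ.* toℕ y)) (≋-reflexive (pos-* (toℕ x) (toℕ y)))

  toℤ-negF : ∀ x → toℤ (-F x) ≋ - toℤ x
  toℤ-negF x = begin
    toℤ (-F x)            ≈⟨ toℤ-mod (p ℕ.∸ toℕ x) ⟩
    + (p ℕ.∸ toℕ x)       ≡⟨ ⊖-≥ (ℕ.<⇒≤ (toℕ<n x)) ⟨
    p ⊖ toℕ x             ≡⟨ [+m]-[+n]≡m⊖n p (toℕ x) ⟨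
    + p - toℤ x           ≡⟨ wrap (toℤ x) (+ p) ⟩
    - toℤ x + 1ℤ * + p    ≈⟨ +-multiple (- toℤ x) 1ℤ ⟩
    - toℤ x               ∎
    where
    wrap : ∀ x p → p - x ≡ - x + 1ℤ * p
    wrap = solve-∀

  toℤ-subF : ∀ x y → toℤ (x -F y) ≋ toℤ x - toℤ y
  toℤ-subF x y = ≋-trans (toℤ-+F x (-F y)) (+-cong (≋-refl {toℤ x}) (toℤ-negF y))

  toℤ-injective : ∀ {x y} → toℤ x ≋ toℤ y → x ≡ y
  toℤ-injective {x} {y} (mk≋ p∣x-y) =
    toℕ-injective (+-injective (i-j≡0⇒i≡j (toℤ x) (toℤ y) (∣i∣≡0⇒i≡0 distance≡0)))
    where
    distance<p : ∣ toℤ x - toℤ y ∣ ℕ.< p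
    distance<p = ℕ.≤-<-trans
      (subst (ℕ._≤ toℕ x ℕ.⊔ toℕ y) (cong ∣_∣ (sym ([+m]-[+n]≡m⊖n (toℕ x) (toℕ y))))
             (∣m⊝n∣≤m⊔n (toℕ x) (toℕ y)))
      (ℕ.⊔-lub (toℕ<n x) (toℕ<n y))
    distance≡0 : ∣ toℤ x - toℤ y ∣ ≡ 0
    distance≡0 = trans (sym (m<n⇒m%n≡m distance<p)) (ℕ.n∣m⇒m%n≡0 _ p (∣⇒∣ᵤ p∣x-y))

  record Shifted (x y : Point p) (L t : ℤ) : Set where
    constructor shifted
    field
      shifted₁ : toℤ (proj₁ x) ≋ toℤ (proj₁ y) + L * t
      shifted₂ : toℤ (proj₂ x) ≋ toℤ (proj₂ y) + L * (t * t)

  ≡-shift⇒Shifted : ∀ {x y} l t → x ≡ y +P (l ·par t) → Shifted x y (toℤ l) (toℤ t)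
  ≡-shift⇒Shifted {y = y₁ , y₂} l t refl = shifted
    (≋-trans (toℤ-+F y₁ (l *F t)) (+-cong (≋-refl {toℤ y₁}) (toℤ-*F l t)))
    (≋-trans (toℤ-+F y₂ (l *F (t *F t)))
      (+-cong (≋-refl {toℤ y₂}) (≋-trans (toℤ-*F l (t *F t)) (*-cong (≋-refl {toℤ l}) (toℤ-*F t t)))))

  Shifted⇒≡-shift : ∀ {x y} l t → Shifted x y (toℤ l) (toℤ t) → x ≡ y +P (l ·par t)
  Shifted⇒≡-shift {x₁ , x₂} {y} l t (shifted x₁≋ x₂≋) =
    let shifted y₁≋ y₂≋ = ≡-shift⇒Shifted {y +P (l ·par t)} {y} l t refl
    in cong₂ _,_ (toℤ-injective (≋-trans x₁≋ (≋-sym y₁≋))) (toℤ-injective (≋-trans x₂≋ (≋-sym y₂≋)))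

  Shifted-scale : ∀ {x y L L′ t} → L ≋ L′ → Shifted x y L t → Shifted x y L′ t
  Shifted-scale {y = y₁ , y₂} {t = t} L≋L′ (shifted x₁≋ x₂≋) = shifted
    (≋-trans x₁≋ (+-cong (≋-refl {toℤ y₁}) (*-cong L≋L′ (≋-refl {t}))))
    (≋-trans x₂≋ (+-cong (≋-refl {toℤ y₂}) (*-cong L≋L′ (≋-refl {t * t}))))

  Shifted-compose : ∀ {v z w} Lk Ll t → Shifted w z (Ll - Lk) t → Shifted z v Lk t → Shifted w v Ll t
  Shifted-compose {v₁ , v₂} {z₁ , z₂} {w₁ , w₂} Lk Ll t (shifted w₁≋ w₂≋) (shifted z₁≋ z₂≋) = shifted
    (shift-compose {toℤ v₁} {toℤ z₁} {toℤ w₁} Lk Ll t w₁≋ z₁≋)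
    (shift-compose {toℤ v₂} {toℤ z₂} {toℤ w₂} Lk Ll (t * t) w₂≋ z₂≋)

  cycle-chords : ∀ {v x z w} Li Lk Ll A B C →
    Shifted x v Li A → Shifted z v Lk A → Shifted w z (Ll - Lk) B → Shifted x w (Li - Ll) C →
    (+ p ∣ (Ll - Lk) * (B - A) + (Li - Ll) * (C - A)) ×
    (+ p ∣ (Ll - Lk) * (B * B - A * A) + (Li - Ll) * (C * C - A * A))
  cycle-chords {v₁ , v₂} {x₁ , x₂} {z₁ , z₂} {w₁ , w₂} Li Lk Ll A B C
               (shifted x₁≋ x₂≋) (shifted z₁≋ z₂≋) (shifted w₁≋ w₂≋) (shifted x₁≋′ x₂≋′) =
      cycle-closing {toℤ v₁} {toℤ x₁} {toℤ z₁} {toℤ w₁} Li Lk Ll A B C x₁≋ z₁≋ w₁≋ x₁≋′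
    , cycle-closing {toℤ v₂} {toℤ x₂} {toℤ z₂} {toℤ w₂} Li Lk Ll (A * A) (B * B) (C * C) x₂≋ z₂≋ w₂≋ x₂≋′

module _ {p : ℕ} .{{_ : NonZero p}} (p-prime : Prime p) {m : ℕ} (H : Graph m) {lam : Fin m → 𝔽 p}
         (lam-injective : Injective _≡_ _≡_ lam) {v : Point p} {a : 𝔽 p} where

  open ModularArithmetic p
  open Residues p

  private
    λ-telescope : ∀ Li Lk Ll → (Ll - Lk) + (Li - Ll) ≡ Li - Lk
    λ-telescope = solve-∀

  lam-injective-mod : ∀ {i j} → + p ∣ toℤ (lam i) - toℤ (lam j) → i ≡ j
  lam-injective-mod p∣difference = lam-injective (toℤ-injective (mk≋ p∣difference))

  common-neighbour-in-Hva : ∀ {u u′ w} → u ≢ u′ → InHva H lam v a u → InHva H lam v a u′ →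
                            Adj H lam u′ w → Adj H lam w u → InHva H lam v a w
  common-neighbour-in-Hva {x , i} {z , k} {w , l} u≢u′ x∈ z∈ (kl , b , _ , w≡) (_ , c , _ , x≡) =
    let linear , quadratic = cycle-chords Li Lk Ll A B C x-shift z-shift w-shift x-shift′
    in conclude (parabola-chords-collapse p-prime α β A B C linear quadratic)
    where
    A B C Li Lk Ll α β : ℤ
    A = toℤ a
    B = toℤ b
    C = toℤ c
    Li = toℤ (lam i)
    Lk = toℤ (lam k)
    Ll = toℤ (lam l)
    α = Ll - Lk
    β = Li - Ll
    x-shift : Shifted x v Li A
    x-shift = ≡-shift⇒Shifted (lam i) a x∈
    z-shift : Shifted z v Lk A
    z-shift = ≡-shift⇒Shifted (lam k) a z∈
    w-shift : Shifted w z α B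
    w-shift = Shifted-scale (toℤ-subF (lam l) (lam k)) (≡-shift⇒Shifted (lam l -F lam k) b w≡)
    x-shift′ : Shifted x w β C
    x-shift′ = Shifted-scale (toℤ-subF (lam i) (lam l)) (≡-shift⇒Shifted (lam i -F lam l) c x≡)
    conclude : (+ p ∣ α) ⊎ (+ p ∣ α + β) ⊎ (+ p ∣ B - A) → InHva H lam v a (w , l)
    conclude (inj₁ p∣α) = contradiction (subst (E H k) (lam-injective-mod p∣α) kl) (E-irr H)
    conclude (inj₂ (inj₁ p∣α+β)) = contradiction (cong₂ _,_ x≡z i≡k) u≢u′
      where
      i≡k : i ≡ k
      i≡k = lam-injective-mod (subst (+ p ∣_) (λ-telescope Li Lk Ll) p∣α+β)
      x≡z : x ≡ z
      x≡z = trans x∈ (trans (cong (λ j → v +P (lam j ·par a)) i≡k) (sym z∈))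
    conclude (inj₂ (inj₂ p∣b-a)) = Shifted⇒≡-shift (lam l) a
      (Shifted-compose Lk Ll A (subst (Shifted w z α ∘ toℤ) (toℤ-injective (mk≋ p∣b-a)) w-shift) z-shift)

lemma4 : (p : ℕ) .{{_ : NonZero p}} → Prime p →
         (m : ℕ) (H : Graph m) (lam : Fin m → 𝔽 p) → Injective _≡_ _≡_ lam →
         (v : Point p) (a : 𝔽 p) → a ≢ 0F →
         (u₁ u₂ u₃ u₄ : Vertex p m) → IsFourCycle H lam u₁ u₂ u₃ u₄ →
         InHva H lam v a u₁ → InHva H lam v a u₂ → InHva H lam v a u₃ →
         InHva H lam v a u₁ × InHva H lam v a u₂ × InHva H lam v a u₃ × InHva H lam v a u₄
lemma4 p p-prime m H lam lam-injective v a _ u₁ u₂ u₃ u₄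
       (_ , u₁≢u₃ , _ , _ , _ , _ , _ , _ , u₃~u₄ , u₄~u₁) u₁∈ u₂∈ u₃∈ =
  u₁∈ , u₂∈ , u₃∈ , common-neighbour-in-Hva p-prime H lam-injective u₁≢u₃ u₁∈ u₃∈ u₃~u₄ u₄~u₁
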